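{- Let $S$ be a poset and let $(G_i)_{i\in S}$, $(H_i)_{i\in S}$ be families of impartial games such that the ordered joins $S\odot_i G_i$ and $S\odot_i H_i$ are terminating. If $G_i\simeq_1 H_i$ for each $i\in S$, then $S\odot_i G_i\simeq_1 S\odot_i H_i$.
   Context: All games are impartial combinatorial games under normal play; a game is determined by its set of options, $G\to G'$ means $G'$ is an option of $G$, and $\mathbf{0}$ is the empty game. A game is terminating if it admits no infinite sequence of moves. The Grundy number of a terminating game is $\Gamma_0(G)=\operatorname{mex}\{\Gamma_0(G') : G\to G'\}$ (least excluded ordinal). The Grundy set is $\Gamma_1(G)=\{\Gamma_0(G') : G\to G'\}$. $G\simeq_1 H$ means $\Gamma_1(G)=\Gamma_1(H)$. Ordered join: for a poset $S$ and games $(G_i)_{i\in S}$, $S \odot_i G_i$ is the game whose options are exactly the ordered joins $S \odot_i G'_i$ such that for one index $i_0\in S$, $G_{i_0}\to G'_{i_0}$, $G'_i=\mathbf{0}$ for all $i>i_0$, and $G'_i=G_i$ for all other $i$. -}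

module Defs where

open import Level using (0ℓ)
open import Data.Empty using (⊥)
open import Data.Unit using (⊤; tt)
open import Data.Sum using (_⊎_; inj₁; inj₂)
open import Data.Product using (Σ; Σ-syntax; _×_; _,_)
open import Relation.Nullary using (¬_; Dec; yes; no)
open import Relation.Binary using (Rel)
open import Relation.Binary.PropositionalEquality using (_≡_; refl)
open import Function.Bundles using (_⇔_)
open import Axiom.ExcludedMiddle using (ExcludedMiddle)

-- Arbitrary graphs (possibly with infinite plays or cycles) are allowed.  Games are only ever observed through their options, so
-- everything below depends only on the option structure.

record Game : Set₁ where
  field
    Pos   : Set
    Opts  : Pos → Set
    moveP : (p : Pos) → Opts p → Pos
    start : Pos
open Game public

Opt : Game → Set
Opt G = Opts G (start G)

at : (G : Game) → Pos G → Game
at G p = record { Pos = Pos G ; Opts = Opts G ; moveP = moveP G ; start = p }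

opt : (G : Game) → Opt G → Game
opt G o = at G (moveP G (start G) o)

𝟎 : Game
𝟎 = record { Pos = ⊤ ; Opts = λ _ → ⊥ ; moveP = λ _ () ; start = tt }

data Terminating (G : Game) : Set where
  term : (∀ o → Terminating (opt G o)) → Terminating G

-- Ordinals: (generalised) Brouwer trees with branching over any small
-- type, compared by rank.  Classically, modulo ≤ ∩ ≥ these are exactly
-- the ordinals below the universe bound, which contain all Grundy
-- numbers of games with Set-indexed options.

data Ord : Set₁ where
  sup : (A : Set) → (A → Ord) → Ord

mutual
  _≤ₒ_ : Ord → Ord → Set
  sup A f ≤ₒ y = ∀ a → f a <ₒ y

  _<ₒ_ : Ord → Ord → Set
  x <ₒ sup B g = Σ[ b ∈ B ] (x ≤ₒ g b)

-- Grundy number, as a relation: Γ₀(G) = α  iff  α = mex Γ₁(G), i.e.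
-- every β < α is the Grundy number of an option, and α is not.
-- Defined by recursion on the termination proof.

GrundyT : (G : Game) → Terminating G → Ord → Set₁
GrundyT G (term t) α =
  (∀ β → β <ₒ α → Σ[ o ∈ Opt G ] GrundyT (opt G o) (t o) β)
  × (∀ o → ¬ GrundyT (opt G o) (t o) α)

HasGrundy : Game → Ord → Set₁
HasGrundy G α = Σ[ t ∈ Terminating G ] GrundyT G t α

_∈Γ₁_ : Ord → Game → Set₁
α ∈Γ₁ G = Σ[ o ∈ Opt G ] HasGrundy (opt G o) α

_≃₁_ : Game → Game → Set₁
G ≃₁ H = ∀ α → (α ∈Γ₁ G) ⇔ (α ∈Γ₁ H)

module _ (lem : ExcludedMiddle 0ℓ) {I : Set} (_≤_ : Rel I 0ℓ) where

  -- positions of the join: one component per index, each either a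
  -- position of G_i's graph (inj₁) or the empty game 𝟎 (inj₂ tt)
  Comp : (I → Game) → I → Set
  Comp G i = Pos (G i) ⊎ ⊤

  CompOpts : (G : I → Game) (i : I) → Comp G i → Set
  CompOpts G i (inj₁ p) = Opts (G i) p
  CompOpts G i (inj₂ _) = ⊥

  update : (G : I → Game) → ((i : I) → Comp G i) → (i₀ : I) → Comp G i₀
         → (i : I) → Comp G i
  update G f i₀ c j with lem {j ≡ i₀}
  ... | yes refl = c
  ... | no _ with lem {i₀ ≤ j}
  ...   | yes _ = inj₂ tt
  ...   | no _  = f j

  JOpts : (G : I → Game) → ((i : I) → Comp G i) → Set
  JOpts G f = Σ[ i ∈ I ] CompOpts G i (f i)

  JMove : (G : I → Game) (f : (i : I) → Comp G i) → JOpts G f → (i : I) → Comp G i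
  JMove G f (i₀ , o) with f i₀
  ... | inj₁ p = update G f i₀ (inj₁ (moveP (G i₀) p o))

  orderedJoin : (I → Game) → Game
  orderedJoin G = record
    { Pos   = (i : I) → Comp G i
    ; Opts  = JOpts G
    ; moveP = JMove G
    ; start = λ i → inj₁ (start (G i))
    }

-- Two positions of the ordered joins are related when, index by index, the
-- components either have the same Grundy set, or have the same Grundy number
-- while every component strictly above is exhausted on both sides.  At the
-- start all components are related by ≃₁, and a move in component k leaves
-- k with equal Grundy numbers on both sides and empties everything above k.
-- Related positions have equal Grundy numbers: an option of one side is
-- answered either by the mirror move in the same component of the other
-- side, or (when the moved component overshoots) by a reversing move back
-- into it, and this mex argument goes through by induction on termination.
-- From the start every option of one join is mirrored in the other, so the
-- two joins have the same Grundy set.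

module Submission where

open import Defs
open import Level using (0ℓ)
open import Relation.Binary using (Rel; IsPartialOrder)
open import Axiom.ExcludedMiddle using (ExcludedMiddle)
open import Axiom.DoubleNegationElimination using (em⇒dne)
open import Data.Empty using (⊥; ⊥-elim)
open import Data.Sum using (_⊎_; inj₁; inj₂)
open import Data.Product using (Σ; Σ-syntax; _×_; _,_; proj₁; proj₂)
open import Relation.Nullary using (¬_; yes; no)
open import Relation.Binary.PropositionalEquality
  using (_≡_; _≢_; refl; sym; trans; subst; subst₂; cong)
open import Function.Bundles using (mk⇔; Equivalence)
open import Function.Properties.Equivalence using () renaming (sym to ⇔-sym)
open import Induction.WellFounded using (Acc; acc; WellFounded)

≤ₒ-refl : ∀ x → x ≤ₒ x
≤ₒ-refl (sup A f) a = a , ≤ₒ-refl (f a)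

mutual
  ≤ₒ-trans : ∀ {x y z} → x ≤ₒ y → y ≤ₒ z → x ≤ₒ z
  ≤ₒ-trans {sup A f} x≤y y≤z a = <ₒ-≤ₒ-trans (x≤y a) y≤z

  <ₒ-≤ₒ-trans : ∀ {x y z} → x <ₒ y → y ≤ₒ z → x <ₒ z
  <ₒ-≤ₒ-trans {y = sup B g} (b , x≤gb) y≤z = ≤ₒ-<ₒ-trans x≤gb (y≤z b)

  ≤ₒ-<ₒ-trans : ∀ {x y z} → x ≤ₒ y → y <ₒ z → x <ₒ z
  ≤ₒ-<ₒ-trans {z = sup C h} x≤y (c , y≤hc) = c , ≤ₒ-trans x≤y y≤hc

<ₒ-irrefl : ∀ {x} → ¬ (x <ₒ x)
<ₒ-irrefl {sup A f} (a , x≤fa) = <ₒ-irrefl (x≤fa a)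

<ₒ-wellFounded : WellFounded _<ₒ_
<ₒ-wellFounded x = acc-≤ₒ x (≤ₒ-refl x)
  where
  acc-≤ₒ : ∀ x {y} → y ≤ₒ x → Acc _<ₒ_ y
  acc-≤ₒ (sup A f) y≤x = acc λ z<y →
    let (a , z≤fa) = <ₒ-≤ₒ-trans z<y y≤x in acc-≤ₒ (f a) z≤fa

_≈ₒ_ : Ord → Ord → Set
x ≈ₒ y = (x ≤ₒ y) × (y ≤ₒ x)

module ClassicalOrd (lem : ∀ {ℓ} → ExcludedMiddle ℓ) where

  dne : ∀ {ℓ} {P : Set ℓ} → ¬ ¬ P → P
  dne = em⇒dne lem

  mutual
    ≰ₒ⇒>ₒ : ∀ {x y} → ¬ (x ≤ₒ y) → y <ₒ x
    ≰ₒ⇒>ₒ {sup A f} {y} x≰y =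
      let (a , fa≮y) = dne λ none → x≰y λ a → dne λ fa≮y → none (a , fa≮y)
      in a , ≮ₒ⇒≥ₒ fa≮y

    ≮ₒ⇒≥ₒ : ∀ {x y} → ¬ (x <ₒ y) → y ≤ₒ x
    ≮ₒ⇒≥ₒ {y = sup B g} x≮y b = ≰ₒ⇒>ₒ λ x≤gb → x≮y (b , x≤gb)

  ≤ₒ-total : ∀ x y → (x ≤ₒ y) ⊎ (y <ₒ x)
  ≤ₒ-total x y with lem {P = x ≤ₒ y}
  ... | yes x≤y = inj₁ x≤y
  ... | no x≰y = inj₂ (≰ₒ⇒>ₒ x≰y)

  module _ {A : Set} (h : A → Ord) where

    Attained : Ord → Set
    Attained γ = Σ[ a ∈ A ] (h a ≈ₒ γ)

    IsMex : Ord → Set₁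
    IsMex μ = (∀ {γ} → γ <ₒ μ → Attained γ) × ¬ Attained μ

    -- Without a mex, well-founded induction makes every ordinal attained,
    -- even sup A h, which lies strictly above each h a.
    mex : Σ Ord IsMex
    mex = dne λ noMex →
      let (a , _ , sup≤ha) = attained noMex (sup A h) (<ₒ-wellFounded _)
      in <ₒ-irrefl (≤ₒ-<ₒ-trans {z = sup A h} sup≤ha (a , ≤ₒ-refl (h a)))
      where
      attained : ¬ Σ Ord IsMex → ∀ γ → Acc _<ₒ_ γ → Attained γ
      attained noMex γ (acc rs) = dne λ ¬att →
        noMex (γ , (λ {γ′} γ′<γ → attained noMex γ′ (rs γ′<γ)) , ¬att)

GrundyT-resp-≈ₒ : ∀ G t {α β} → GrundyT G t α → α ≈ₒ β → GrundyT G t β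
GrundyT-resp-≈ₒ G (term t) (below , notOpt) (α≤β , β≤α) =
  (λ γ γ<β → below γ (<ₒ-≤ₒ-trans γ<β β≤α)) ,
  (λ o grundy → notOpt o (GrundyT-resp-≈ₒ (opt G o) (t o) grundy (β≤α , α≤β)))

GrundyT-irrelevant : ∀ G t t′ {α} → GrundyT G t α → GrundyT G t′ α
GrundyT-irrelevant G (term t) (term t′) (below , notOpt) =
  (λ γ γ<α → let (o , grundy) = below γ γ<α
             in o , GrundyT-irrelevant (opt G o) (t o) (t′ o) grundy) ,
  (λ o grundy → notOpt o (GrundyT-irrelevant (opt G o) (t′ o) (t o) grundy))

HasGrundy-resp-≈ₒ : ∀ {G α β} → HasGrundy G α → α ≈ₒ β → HasGrundy G β
HasGrundy-resp-≈ₒ {G} (t , grundy) α≈β = t , GrundyT-resp-≈ₒ G t grundy α≈β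

HasGrundy⇒below∈Γ₁ : ∀ {G α γ} → HasGrundy G α → γ <ₒ α → γ ∈Γ₁ G
HasGrundy⇒below∈Γ₁ (term t , below , _) γ<α =
  let (o , grundy) = below _ γ<α in o , t o , grundy

HasGrundy⇒∉Γ₁ : ∀ {G α} → HasGrundy G α → ¬ (α ∈Γ₁ G)
HasGrundy⇒∉Γ₁ {G} (term t , _ , notOpt) (o , t′ , grundy) =
  notOpt o (GrundyT-irrelevant (opt G o) t′ (t o) grundy)

_≃₀_ : Game → Game → Set₁
G ≃₀ H = Σ[ α ∈ Ord ] (HasGrundy G α × HasGrundy H α)

≃₀-sym : ∀ {G H} → G ≃₀ H → H ≃₀ G
≃₀-sym (α , hG , hH) = α , hH , hG

≃₁-sym : ∀ {G H} → G ≃₁ H → H ≃₁ G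
≃₁-sym G≃H α = ⇔-sym (G≃H α)

MirrorMove : (G H : Game) → Opt G → Set₁
MirrorMove G H o = Σ[ o′ ∈ Opt H ] (opt G o ≃₀ opt H o′)

ReversingMove : (G H : Game) → Opt G → Set₁
ReversingMove G H o = Σ[ o′ ∈ Opt (opt G o) ] (opt (opt G o) o′ ≃₀ H)

OptionsAnswered : Game → Game → Set₁
OptionsAnswered G H = ∀ o → MirrorMove G H o ⊎ ReversingMove G H o

module ClassicalGrundy (lem : ∀ {ℓ} → ExcludedMiddle ℓ) where
  open ClassicalOrd lem

  HasGrundy-unique : ∀ {G α β} → HasGrundy G α → HasGrundy G β → α ≈ₒ β
  HasGrundy-unique hα hβ = ≤-by-mex hα hβ , ≤-by-mex hβ hα
    where
    ≤-by-mex : ∀ {G α β} → HasGrundy G α → HasGrundy G β → α ≤ₒ β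
    ≤-by-mex {α = α} {β} hα hβ with ≤ₒ-total α β
    ... | inj₁ α≤β = α≤β
    ... | inj₂ β<α = ⊥-elim (HasGrundy⇒∉Γ₁ hβ (HasGrundy⇒below∈Γ₁ hα β<α))

  HasGrundy-≃₀ : ∀ {G H α} → G ≃₀ H → HasGrundy G α → HasGrundy H α
  HasGrundy-≃₀ (β , hG , hH) hα = HasGrundy-resp-≈ₒ hH (HasGrundy-unique hG hα)

  grundy : ∀ {G} → Terminating G → Σ Ord (HasGrundy G)
  grundy {G} t@(term ts) =
    let (μ , below , notAttained) = mex (λ o → proj₁ (grundy (ts o)))
    in μ , t ,
       (λ γ γ<μ → let (o , v≈γ) = below γ<μ
                      (t′ , gr) = HasGrundy-resp-≈ₒ (proj₂ (grundy (ts o))) v≈γ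
                  in o , GrundyT-irrelevant (opt G o) t′ (ts o) gr) ,
       (λ o gr → notAttained
                   (o , HasGrundy-unique (proj₂ (grundy (ts o))) (ts o , gr)))

  answers⇒≤ₒ : ∀ {G H α β} → HasGrundy G α → HasGrundy H β
             → OptionsAnswered G H → α ≤ₒ β
  answers⇒≤ₒ {α = α} {β} hG hH answered with ≤ₒ-total α β
  ... | inj₁ α≤β = α≤β
  ... | inj₂ β<α with HasGrundy⇒below∈Γ₁ hG β<α
  ...   | o , hβ with answered o
  ...     | inj₁ (o′ , same) =
              ⊥-elim (HasGrundy⇒∉Γ₁ hH (o′ , HasGrundy-≃₀ same hβ))
  ...     | inj₂ (o′ , same) =
              ⊥-elim (HasGrundy⇒∉Γ₁ hβ (o′ , HasGrundy-≃₀ (≃₀-sym same) hH))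

  ≃₀-by-answers : ∀ {G H} → Terminating G → Terminating H
                → OptionsAnswered G H → OptionsAnswered H G → G ≃₀ H
  ≃₀-by-answers tG tH G→H H→G =
    let (α , hG) = grundy tG
        (β , hH) = grundy tH
    in α , hG ,
       HasGrundy-resp-≈ₒ hH (answers⇒≤ₒ hH hG H→G , answers⇒≤ₒ hG hH G→H)

module OrderedJoin (lem : ∀ {ℓ} → ExcludedMiddle ℓ) {I : Set} (_≤_ : Rel I 0ℓ) where
  open ClassicalOrd lem using (≤ₒ-total)
  open ClassicalGrundy lem

  Position : (I → Game) → Set
  Position K = (i : I) → Comp lem _≤_ K i

  join : (K : I → Game) → Position K → Game
  join K f = at (orderedJoin lem _≤_ K) f

  move : (K : I → Game) (f : Position K) (k : I)
       → CompOpts lem _≤_ K k (f k) → Position K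
  move K f k o = JMove lem _≤_ K f (k , o)

  component : (K : I → Game) (i : I) → Comp lem _≤_ K i → Game
  component K i (inj₁ p) = at (K i) p
  component K i (inj₂ _) = 𝟎

  componentOpt : ∀ K i c → CompOpts lem _≤_ K i c → Opt (component K i c)
  componentOpt K i (inj₁ p) o = o

  joinOpt : ∀ K i c → Opt (component K i c) → CompOpts lem _≤_ K i c
  joinOpt K i (inj₁ p) o = o

  Dead : (K : I → Game) (i : I) → Comp lem _≤_ K i → Set
  Dead K i c = ¬ CompOpts lem _≤_ K i c

  DeadAbove : (K : I → Game) → I → Position K → Set
  DeadAbove K k f = ∀ {j} → k ≤ j → j ≢ k → Dead K j (f j)

  dead-≃₁ : ∀ G H i c d → Dead G i c → Dead H i d
          → component G i c ≃₁ component H i d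
  dead-≃₁ G H i c d deadG deadH α =
    mk⇔ (λ (o , _) → ⊥-elim (deadG (joinOpt G i c o)))
        (λ (o , _) → ⊥-elim (deadH (joinOpt H i d o)))

  module _ {K : I → Game} {f : Position K} {k : I} {c : Comp lem _≤_ K k} where

    update-self : update lem _≤_ K f k c k ≡ c
    update-self with lem {P = k ≡ k}
    ... | yes refl = refl
    ... | no k≢k = ⊥-elim (k≢k refl)

    update-above : DeadAbove K k (update lem _≤_ K f k c)
    update-above {j} k≤j j≢k with lem {P = j ≡ k}
    ... | yes j≡k = ⊥-elim (j≢k j≡k)
    ... | no _ with lem {P = k ≤ j}
    ...   | yes _ = λ ()
    ...   | no k≰j = ⊥-elim (k≰j k≤j)

    update-other : ∀ {j} → j ≢ k → ¬ k ≤ j → update lem _≤_ K f k c j ≡ f j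
    update-other {j} j≢k k≰j with lem {P = j ≡ k}
    ... | yes j≡k = ⊥-elim (j≢k j≡k)
    ... | no _ with lem {P = k ≤ j}
    ...   | yes k≤j = ⊥-elim (k≰j k≤j)
    ...   | no _ = refl

  component-after-move : ∀ K f k o →
    component K k (move K f k o k) ≡ opt (component K k (f k)) (componentOpt K k (f k) o)
  component-after-move K f k o with f k
  ... | inj₁ p = cong (component K k) update-self

  component-after-move′ : ∀ K f k o →
    component K k (move K f k (joinOpt K k (f k) o) k) ≡ opt (component K k (f k)) o
  component-after-move′ K f k o with f k
  ... | inj₁ p = cong (component K k) update-self

  moved-component-∈Γ₁ : ∀ K f k o {γ} → HasGrundy (component K k (move K f k o k)) γ
    → γ ∈Γ₁ component K k (f k)
  moved-component-∈Γ₁ K f k o h =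
    componentOpt K k (f k) o , subst (λ X → HasGrundy X _) (component-after-move K f k o) h

  ∈Γ₁-moved-component : ∀ K f k o {γ} → HasGrundy (opt (component K k (f k)) o) γ
    → HasGrundy (component K k (move K f k (joinOpt K k (f k) o) k)) γ
  ∈Γ₁-moved-component K f k o h =
    subst (λ X → HasGrundy X _) (sym (component-after-move′ K f k o)) h

  component-terminating : ∀ K f → Terminating (join K f)
    → ∀ k → Terminating (component K k (f k))
  component-terminating K f (term t) k = term λ o →
    subst Terminating (component-after-move′ K f k o)
      (component-terminating K _ (t (k , joinOpt K k (f k) o)) k)

  record PlayedIn (K : I → Game) (k : I) (f f′ : Position K) : Set where
    field
      kills-above : DeadAbove K k f′
      keeps-rest  : ∀ {j} → j ≢ k → ¬ k ≤ j → f′ j ≡ f j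

    dead-stays-dead : ∀ {j} → j ≢ k → Dead K j (f j) → Dead K j (f′ j)
    dead-stays-dead {j} j≢k dead with lem {P = k ≤ j}
    ... | yes k≤j = kills-above k≤j j≢k
    ... | no k≰j = subst (Dead K j) (sym (keeps-rest j≢k k≰j)) dead

  open PlayedIn

  move-playedIn : ∀ K f k o → PlayedIn K k f (move K f k o)
  move-playedIn K f k o with f k
  ... | inj₁ p = record { kills-above = update-above ; keeps-rest = update-other }

  playedIn-trans : ∀ {K k f f′ f″}
    → PlayedIn K k f f′ → PlayedIn K k f′ f″ → PlayedIn K k f f″
  playedIn-trans f→f′ f′→f″ = record
    { kills-above = kills-above f′→f″
    ; keeps-rest  = λ j≢k k≰j →
        trans (keeps-rest f′→f″ j≢k k≰j) (keeps-rest f→f′ j≢k k≰j)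
    }

  deadAbove⇒playedIn-refl : ∀ {K k f} → DeadAbove K k f → PlayedIn K k f f
  deadAbove⇒playedIn-refl dead = record { kills-above = dead ; keeps-rest = λ _ _ → refl }

  deadAbove-after-play : ∀ {K i k f f′} → (i ≤ k → k ≢ i → ⊥)
    → DeadAbove K i f → PlayedIn K k f f′ → DeadAbove K i f′
  deadAbove-after-play {k = k} k≯i dead played {j} i≤j j≢i with lem {P = j ≡ k}
  ... | yes refl = ⊥-elim (k≯i i≤j j≢i)
  ... | no j≢k = dead-stays-dead played j≢k (dead i≤j j≢i)

  Matched : (G H : I → Game) → I → Position G → Position H → Set₁
  Matched G H i f g =
      (component G i (f i) ≃₁ component H i (g i))
    ⊎ (component G i (f i) ≃₀ component H i (g i) × DeadAbove G i f × DeadAbove H i g)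

  Related : (G H : I → Game) → Position G → Position H → Set₁
  Related G H f g = ∀ i → Matched G H i f g

  related-sym : ∀ {G H f g} → Related G H f g → Related H G g f
  related-sym r i with r i
  ... | inj₁ same₁ = inj₁ (≃₁-sym same₁)
  ... | inj₂ (same₀ , deadG , deadH) = inj₂ (≃₀-sym same₀ , deadH , deadG)

  related-after-play : ∀ {G H f g f′ g′ k}
    → Related G H f g → CompOpts lem _≤_ G k (f k)
    → PlayedIn G k f f′ → PlayedIn H k g g′
    → component G k (f′ k) ≃₀ component H k (g′ k) → Related G H f′ g′
  related-after-play {G} {H} {f′ = f′} {g′} {k} r live playedG playedH same₀ i
    with lem {P = i ≡ k}
  ... | yes refl = inj₂ (same₀ , kills-above playedG , kills-above playedH)
  ... | no i≢k with lem {P = k ≤ i}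
  ...   | yes k≤i = inj₁ (dead-≃₁ G H i (f′ i) (g′ i)
                            (kills-above playedG k≤i i≢k) (kills-above playedH k≤i i≢k))
  ...   | no k≰i with keeps-rest playedG i≢k k≰i | keeps-rest playedH i≢k k≰i | r i
  ...     | f′i≡fi | g′i≡gi | inj₁ same₁ =
            inj₁ (subst₂ (λ c d → component G i c ≃₁ component H i d)
                         (sym f′i≡fi) (sym g′i≡gi) same₁)
  ...     | f′i≡fi | g′i≡gi | inj₂ (sameᵢ , deadG , deadH) =
            inj₂ ( subst₂ (λ c d → component G i c ≃₀ component H i d)
                          (sym f′i≡fi) (sym g′i≡gi) sameᵢ
                 , deadAbove-after-play k≯i deadG playedG
                 , deadAbove-after-play k≯i deadH playedH )
    where
    k≯i : i ≤ k → k ≢ i → ⊥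
    k≯i i≤k k≢i = deadG i≤k k≢i live

  mutual
    related⇒≃₀ : ∀ {G H f g} → Terminating (join G f) → Terminating (join H g)
      → Related G H f g → join G f ≃₀ join H g
    related⇒≃₀ {G} {H} {f} {g} tf tg r =
      ≃₀-by-answers tf tg (related⇒answered tf tg r)
        (related⇒answered tg tf (related-sym {G} {H} {f} {g} r))

    related⇒answered : ∀ {G H f g} → Terminating (join G f) → Terminating (join H g)
      → Related G H f g → OptionsAnswered (join G f) (join H g)
    related⇒answered tf tg r (k , o) with r k
    ... | inj₁ same₁ = inj₁ (mirror-in-≃₁-component tf tg r k o same₁)
    ... | inj₂ (same₀ , _ , deadH) = answer-in-≃₀-component tf tg r k o same₀ deadH

    mirror-move : ∀ {G H f g} → Terminating (join G f) → Terminating (join H g)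
      → Related G H f g → ∀ k o {γ} → HasGrundy (component G k (move G f k o k)) γ
      → γ ∈Γ₁ component H k (g k) → MirrorMove (join G f) (join H g) (k , o)
    mirror-move {G} {H} {f} {g} (term tf) (term tg) r k o hG (o′ , hH) =
      (k , oH) ,
      related⇒≃₀ (tf (k , o)) (tg (k , oH))
        (related-after-play r o (move-playedIn G f k o) (move-playedIn H g k oH)
          (_ , hG , ∈Γ₁-moved-component H g k o′ hH))
      where
      oH = joinOpt H k (g k) o′

    mirror-in-≃₁-component : ∀ {G H f g} → Terminating (join G f) → Terminating (join H g)
      → Related G H f g → ∀ k o → component G k (f k) ≃₁ component H k (g k)
      → MirrorMove (join G f) (join H g) (k , o)
    mirror-in-≃₁-component {G} {f = f} tf@(term ts) tg r k o same₁ =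
      let (γ , hγ) = grundy (component-terminating G _ (ts (k , o)) k)
      in mirror-move tf tg r k o hγ
           (Equivalence.to (same₁ γ) (moved-component-∈Γ₁ G f k o hγ))

    -- Playing to a value below δ is mirrored; overshooting δ is reversed
    -- by a second move in component k down to δ.
    answer-in-≃₀-component : ∀ {G H f g} → Terminating (join G f) → Terminating (join H g)
      → Related G H f g → ∀ k o → component G k (f k) ≃₀ component H k (g k)
      → DeadAbove H k g
      → MirrorMove (join G f) (join H g) (k , o)
      ⊎ ReversingMove (join G f) (join H g) (k , o)
    answer-in-≃₀-component {G} {H} {f} {g} tf@(term ts) tg r k o
                           (δ , hGk , hHk) deadH
      with grundy (component-terminating G _ (ts (k , o)) k)
    ... | γ , hγ with ≤ₒ-total δ γ
    ...   | inj₂ γ<δ =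
              inj₁ (mirror-move tf tg r k o hγ (HasGrundy⇒below∈Γ₁ hHk γ<δ))
    ...   | inj₁ δ≤γ with ≤ₒ-total γ δ
    ...     | inj₁ γ≤δ =
                ⊥-elim (HasGrundy⇒∉Γ₁ hGk
                  (moved-component-∈Γ₁ G f k o (HasGrundy-resp-≈ₒ hγ (γ≤δ , δ≤γ))))
    ...     | inj₂ δ<γ with HasGrundy⇒below∈Γ₁ hγ δ<γ | ts (k , o)
    ...       | o′ , hδ | term ts′ =
                inj₂ ((k , oG) ,
                  related⇒≃₀ {G} {H} {move G f′ k oG} {g} (ts′ (k , oG)) tg
                    (related-after-play r o
                      (playedIn-trans (move-playedIn G f k o) (move-playedIn G f′ k oG))
                      (deadAbove⇒playedIn-refl {H} {k} {g} deadH)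
                      (δ , ∈Γ₁-moved-component G f′ k o′ hδ , hHk)))
      where
      f′ = move G f k o
      oG = joinOpt G k (f′ k) o′

  orderedJoin-Γ₁-⊆ : ∀ {G H} → Terminating (orderedJoin lem _≤_ G)
    → Terminating (orderedJoin lem _≤_ H) → (∀ i → G i ≃₁ H i)
    → ∀ {α} → α ∈Γ₁ orderedJoin lem _≤_ G → α ∈Γ₁ orderedJoin lem _≤_ H
  orderedJoin-Γ₁-⊆ tG tH G≃H ((k , o) , hα) =
    let (o′ , same) = mirror-in-≃₁-component tG tH (λ i → inj₁ (G≃H i)) k o (G≃H k)
    in o′ , HasGrundy-≃₀ same hα

theorem4p2 : (lem : ∀ {ℓ} → ExcludedMiddle ℓ)
    → (I : Set) (_≤_ : Rel I 0ℓ) → IsPartialOrder _≡_ _≤_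
    → (G H : I → Game)
    → Terminating (orderedJoin lem _≤_ G)
    → Terminating (orderedJoin lem _≤_ H)
    → (∀ i → G i ≃₁ H i)
    → orderedJoin lem _≤_ G ≃₁ orderedJoin lem _≤_ H
theorem4p2 lem I _≤_ _ G H tG tH G≃H α =
  mk⇔ (orderedJoin-Γ₁-⊆ tG tH G≃H)
      (orderedJoin-Γ₁-⊆ tH tG (λ i → ≃₁-sym (G≃H i)))
  where open OrderedJoin lem _≤_
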